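{- Let $\{G_i\}$ be a family of graphs with a common induced subgraph $J$ with embeddings $J_i$, and let $H=\amalg\{(G_i|J_i)\}$. If for a vertex $a\in V(H)$ and an edge $uv\in \parallel(J_i:G_i)$ we have $d_H(a,u)\neq d_H(a,v)$, then $a\in V(G_i-J_i)$.
   Context: All graphs are finite, simple and non-null. $J$ is a common induced subgraph of the graphs $G_i$ if for each $i$ there is an injective map $\iota_i:V(J)\to V(G_i)$ with $\iota_i(u)\iota_i(v)\in E(G_i)$ iff $uv\in E(J)$; $J_i$ denotes the induced subgraph of $G_i$ on $\iota_i(V(J))$. The subgraph-amalgamation $H=\amalg\{(G_i|J_i)\}$ is obtained from the disjoint union of the $G_i$ by identifying, for every $v\in V(J)$, all the vertices $\iota_i(v)$ into a single vertex $v$; thus $V(H)=\bigcup_i V(G_i-J_i)\cup V(J)$, and $E(H)$ consists of the edges of each $G_i-J_i$, the edges of $J$, and the edges $uv$ with $u\in V(G_i-J_i)$, $v\in V(J)$ and $u\iota_i(v)\in E(G_i)$. Each $G_i$ is regarded as a subgraph of $H$. For an induced subgraph $J$ of a graph $G$, an edge $uv$ of $G-J$ (the graph obtained by deleting the vertices of $J$) is parallel to $J$ in $G$ if $d_G(w,u)=d_G(w,v)$ for every $w\in V(J)$; $\parallel(J:G)$ denotes the set of such edges. -}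

module Defs where

open import Data.Nat using (ℕ; zero; suc; _≤_; _<_)
open import Data.Fin using (Fin)
open import Data.Maybe using (Maybe; just; nothing)
open import Data.Product using (Σ; _×_; _,_)
open import Data.Empty using (⊥)
open import Relation.Nullary using (¬_)
open import Relation.Binary.PropositionalEquality using (_≡_; _≢_)
open import Function.Bundles using (_⇔_)

record Graph : Set₁ where
  field
    n         : ℕ
    nonNull   : 0 < n
    Adj       : Fin n → Fin n → Set
    Adj-sym   : ∀ {x y} → Adj x y → Adj y x
    Adj-irref : ∀ {x} → ¬ Adj x x
open Graph public

data Walk {V : Set} (R : V → V → Set) : V → V → ℕ → Set where
  here : ∀ {x} → Walk R x x 0
  step : ∀ {x y z m} → R x y → Walk R y z m → Walk R x z (suc m)

-- Graph distance as a relation: Dist R x y (just d) means d(x,y) = d,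
-- Dist R x y nothing means d(x,y) = ∞ (no walk from x to y).
data Dist {V : Set} (R : V → V → Set) (x y : V) : Maybe ℕ → Set where
  fin : ∀ {d} → Walk R x y d → (∀ m → Walk R x y m → d ≤ m) → Dist R x y (just d)
  inf : (∀ m → ¬ Walk R x y m) → Dist R x y nothing

EqDist : {V : Set} (R : V → V → Set) (w u v : V) → Set
EqDist R w u v = Σ (Maybe ℕ) λ d → Dist R w u d × Dist R w v d

record CommonInduced (J : Graph) {k : ℕ} (G : Fin k → Graph)
                     (ι : (i : Fin k) → Fin (n J) → Fin (n (G i))) : Set where
  field
    inj     : ∀ i {u v} → ι i u ≡ ι i v → u ≡ v
    induced : ∀ i u v → Adj (G i) (ι i u) (ι i v) ⇔ Adj J u v

NotInJ : {k : ℕ} (J : Graph) (G : Fin k → Graph)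
         (ι : (i : Fin k) → Fin (n J) → Fin (n (G i))) (i : Fin k) → Fin (n (G i)) → Set
NotInJ J G ι i x = ∀ v → ι i v ≢ x

module Amalgamation (J : Graph) {k : ℕ} (G : Fin k → Graph)
                    (ι : (i : Fin k) → Fin (n J) → Fin (n (G i))) where

  data HV : Set where
    inJ : Fin (n J) → HV
    inG : (i : Fin k) (x : Fin (n (G i))) → NotInJ J G ι i x → HV

  data HAdj : HV → HV → Set where
    jj : ∀ {u v} → Adj J u v → HAdj (inJ u) (inJ v)
    gg : ∀ {i x y p q} → Adj (G i) x y → HAdj (inG i x p) (inG i y q)
    gj : ∀ {i x v p} → Adj (G i) x (ι i v) → HAdj (inG i x p) (inJ v)
    jg : ∀ {i x v p} → Adj (G i) (ι i v) x → HAdj (inJ v) (inG i x p)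

  data InGminusJ (i : Fin k) : HV → Set where
    mem : ∀ {x p} → InGminusJ i (inG i x p)

Parallel : (J : Graph) {k : ℕ} (G : Fin k → Graph)
           (ι : (i : Fin k) → Fin (n J) → Fin (n (G i))) (i : Fin k)
           (u v : Fin (n (G i))) → Set
Parallel J G ι i u v =
  NotInJ J G ι i u × NotInJ J G ι i v × Adj (G i) u v ×
  (∀ w → EqDist (Adj (G i)) (ι i w) u v)

Parallel-u : (J : Graph) {k : ℕ} (G : Fin k → Graph)
             (ι : (i : Fin k) → Fin (n J) → Fin (n (G i))) (i : Fin k) {u v : Fin (n (G i))} →
             Parallel J G ι i u v → NotInJ J G ι i u
Parallel-u J G ι i (p , _) = p

Parallel-v : (J : Graph) {k : ℕ} (G : Fin k → Graph)
             (ι : (i : Fin k) → Fin (n J) → Fin (n (G i))) (i : Fin k) {u v : Fin (n (G i))} →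
             Parallel J G ι i u v → NotInJ J G ι i v
Parallel-v J G ι i (_ , q , _) = q

-- If a lies in J or in some G_j - J_j with j ≠ i, every walk in H from a to
-- a vertex of G_i - J_i enters G_i through J_i, and its last part is a walk of
-- G_i from some ι_i(w). Since d_{G_i}(ι_i w, u) = d_{G_i}(ι_i w, v), that last
-- part can be rerouted to the other endpoint of the parallel edge without
-- getting longer; so each of u, v is reached from a as fast as the other, and
-- d_H(a,u) = d_H(a,v). The distances exist only classically, which is harmless
-- because the conclusion is decidable.
module Submission where

open import Defs
open import Data.Nat using (ℕ; _+_; _≤_; _<_)
open import Data.Nat.Properties using (≤-trans; ≤-antisym; +-monoʳ-≤; ≮⇒≥)
open import Data.Nat.Induction using (<-rec)
open import Data.Fin using (Fin; _≟_)
open import Data.Fin.Properties using (any?)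
open import Data.Maybe using (just; nothing)
open import Data.Product using (Σ; ∃; _×_; _,_)
open import Relation.Nullary using (¬_; Dec; yes; no)
open import Relation.Nullary.Decidable using (decidable-stable; ¬¬-excluded-middle)
open import Relation.Nullary.Negation using (contradiction)
open import Relation.Binary.PropositionalEquality using (_≡_; refl; subst)
open import Function.Bundles using (Equivalence)

Least : (ℕ → Set) → Set
Least P = Σ ℕ λ d → P d × (∀ m → P m → d ≤ m)

¬¬-least : {P : ℕ → Set} (m : ℕ) → P m → ¬ ¬ Least P
¬¬-least {P} = <-rec (λ m → P m → ¬ ¬ Least P) λ m smaller Pm ¬least →
  ¬¬-excluded-middle {A = ∃ λ m′ → m′ < m × P m′} λ where
    (yes (m′ , m′<m , Pm′)) → smaller m′<m Pm′ ¬least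
    (no ¬below) → ¬least (m , Pm , λ m′ Pm′ → ≮⇒≥ λ m′<m → ¬below (m′ , m′<m , Pm′))

module _ {V : Set} {R : V → V → Set} where

  _++ʷ_ : ∀ {x y z m l} → Walk R x y m → Walk R y z l → Walk R x z (m + l)
  here       ++ʷ w = w
  step e w′ ++ʷ w = step e (w′ ++ʷ w)

  ¬¬-dist : ∀ x y → ¬ ¬ ∃ (Dist R x y)
  ¬¬-dist x y ¬dist = ¬¬-excluded-middle {A = ∃ (Walk R x y)} λ where
    (no ¬walk) → ¬dist (nothing , inf λ m w → ¬walk (m , w))
    (yes (m , w)) → ¬¬-least m w λ (d , wd , least) → ¬dist (just d , fin wd least)

  Shortening : V → V → V → Set
  Shortening a y x = ∀ {m} → Walk R a y m → ∃ λ m′ → m′ ≤ m × Walk R a x m′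

  dist-transfer : ∀ {a x y d} → Shortening a x y → Shortening a y x →
                  Dist R a x d → Dist R a y d
  dist-transfer x→y y→x (inf ¬walk) = inf λ m w → let (_ , _ , w′) = y→x w in ¬walk _ w′
  dist-transfer {a} {y = y} {just d} x→y y→x (fin wd least) with x→y wd
  ... | m′ , m′≤d , w′ = fin (subst (Walk R a y) (≤-antisym m′≤d (least′ m′ w′)) w′) least′
    where
    least′ : ∀ m → Walk R a y m → d ≤ m
    least′ m w = let (m″ , m″≤m , w″) = y→x w in ≤-trans (least m″ w″) m″≤m

  ¬¬-eqDist : ∀ {a x y} → Shortening a x y → Shortening a y x → ¬ ¬ EqDist R a x y
  ¬¬-eqDist {a} {x} x→y y→x ¬eq = ¬¬-dist a x λ (d , dx) →
    ¬eq (d , dx , dist-transfer x→y y→x dx)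

  EqDist-swap : ∀ {w u v} → EqDist R w u v → EqDist R w v u
  EqDist-swap (d , du , dv) = d , dv , du

module AmalgamationDistances (J : Graph) {k : ℕ} (G : Fin k → Graph)
                             (ι : (i : Fin k) → Fin (n J) → Fin (n (G i)))
                             (CI : CommonInduced J G ι) (i : Fin k) where
  open Amalgamation J G ι
  open CommonInduced CI

  InGminusJ? : ∀ a → Dec (InGminusJ i a)
  InGminusJ? (inJ _) = no λ ()
  InGminusJ? (inG j _ _) with j ≟ i
  ... | yes refl = yes mem
  ... | no j≢i   = no λ { mem → j≢i refl }

  data Copy : Fin (n (G i)) → HV → Set where
    copyJ : ∀ {w x} → ι i w ≡ x → Copy x (inJ w)
    copyG : ∀ {x p} → Copy x (inG i x p)

  copy : ∀ x → ∃ (Copy x)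
  copy x with any? (λ w → ι i w ≟ x)
  ... | yes (w , ιw≡x) = inJ w , copyJ ιw≡x
  ... | no ¬image      = inG i x (λ w ιw≡x → ¬image (w , ιw≡x)) , copyG

  copy-adj : ∀ {x y hx hy} → Copy x hx → Copy y hy → Adj (G i) x y → HAdj hx hy
  copy-adj (copyJ refl) (copyJ refl) e = jj (Equivalence.to (induced i _ _) e)
  copy-adj (copyJ refl) copyG        e = jg e
  copy-adj copyG        (copyJ refl) e = gj e
  copy-adj copyG        copyG        e = gg e

  copy-walk : ∀ {x y hx hy m} → Copy x hx → Copy y hy → Walk (Adj (G i)) x y m → Walk HAdj hx hy m
  copy-walk (copyJ refl) (copyJ ιw≡ιw′) here with inj i ιw≡ιw′
  ... | refl = here
  copy-walk (copyJ ιw≡x) (copyG {p = p}) here = contradiction ιw≡x (p _)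
  copy-walk (copyG {p = p}) (copyJ ιw≡x) here = contradiction ιw≡x (p _)
  copy-walk copyG copyG here = here
  copy-walk cx cy (step {y = z} e w) with copy z
  ... | _ , cz = step (copy-adj cx cz e) (copy-walk cz cy w)

  data LastEntry {y : Fin (n (G i))} (q : NotInJ J G ι i y) : HV → ℕ → Set where
    within : ∀ {x p m} → Walk (Adj (G i)) x y m → LastEntry q (inG i x p) m
    via    : ∀ {a w t s} → Walk HAdj a (inJ w) t → Walk (Adj (G i)) (ι i w) y s →
             LastEntry q a (t + s)

  lastEntry : ∀ {y q a m} → Walk HAdj a (inG i y q) m → LastEntry q a m
  lastEntry here = within here
  lastEntry (step e W) with lastEntry W
  lastEntry (step (gg e) W) | within w    = within (step e w)
  lastEntry (step (jg e) W) | within w    = via here (step e w)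
  lastEntry (step e W)      | via w₁ w₂  = via (step e w₁) w₂

  parallel-shortening : ∀ {u v pu pv a} → ¬ InGminusJ i a →
                        (∀ w → EqDist (Adj (G i)) (ι i w) u v) →
                        Shortening a (inG i v pv) (inG i u pu)
  parallel-shortening a∉ eqd W with lastEntry W
  ... | within _ = contradiction mem a∉
  ... | via {w = w} {t} {s} w₁ w₂ with eqd w
  ...   | just d , fin wu _ , fin _ least = t + d , +-monoʳ-≤ t (least s w₂) , w₁ ++ʷ copy-walk (copyJ refl) copyG wu
  ...   | nothing , _ , inf ¬walk = contradiction w₂ (¬walk s)

  parallel-¬¬eqDist : ∀ {u v pu pv a} → ¬ InGminusJ i a →
                      (∀ w → EqDist (Adj (G i)) (ι i w) u v) →
                      ¬ ¬ EqDist HAdj a (inG i u pu) (inG i v pv)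
  parallel-¬¬eqDist a∉ eqd =
    ¬¬-eqDist (parallel-shortening a∉ (λ w → EqDist-swap (eqd w))) (parallel-shortening a∉ eqd)

lemma1 : (J : Graph) (k : ℕ) (G : Fin k → Graph)
         (ι : (i : Fin k) → Fin (n J) → Fin (n (G i))) →
         CommonInduced J G ι →
         (i : Fin k) (u v : Fin (n (G i))) →
         (par : Parallel J G ι i u v) →
         (a : Amalgamation.HV J G ι) →
         ¬ EqDist (Amalgamation.HAdj J G ι) a
             (Amalgamation.inG i u (Parallel-u J G ι i par)) (Amalgamation.inG i v (Parallel-v J G ι i par)) →
         Amalgamation.InGminusJ J G ι i a
lemma1 J k G ι CI i u v (_ , _ , _ , eqd) a ¬eq =
  decidable-stable (InGminusJ? a) λ a∉ → parallel-¬¬eqDist a∉ eqd ¬eq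
  where open AmalgamationDistances J G ι CI i
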